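{- Let $x_0$ be a positive integer and $z_0$ an integer, and set $S_0=x_0+z_0^2$, $m_0=(x_0+z_0^2+z_0)^2/x_0$ and $$y_0=\frac{x_0^3+2x_0^2z_0^2+x_0^2z_0+x_0z_0^4+2x_0z_0^3+3x_0z_0^2+z_0^5+2z_0^4+z_0^3}{(x_0+z_0^2+z_0)^2}.$$ Suppose $S_0,m_0,y_0$ are integers, that the quantities $\Lambda,T,n,k,r,s,\lambda,N,P$ defined below, evaluated at $(S,m,x,y)=(S_0,m_0,x_0,y_0)$, are all (defined and) integers, and that $p_3(S_0,m_0,x_0,y_0)=0$. Then $z_0=0$.
   Context: $p_3(S,m,x,y)=S^2x^2 - Smx^2 - 2S^2xy + 2Smxy + S^2y^2 - Smy^2 + S^2m + 2S^2x - 2Smx - 2Sx^2 + mx^2 - 2S^2y + 2Sxy + S^2 - 2Sx + x^2$. Further, $\Lambda=\frac{S(S-1)(S-x)(S-y)}{S^4-2S^3-((x+y-1)(m-1)-1)S^2+xym(m-1)}$, $T=\frac{(m-1)\Lambda}{S-1}$, $N=\frac{x(m-S)(S(S-1)-y(m-1))\Lambda}{S(x-y)(S-x)(S-1)}$, $P=\frac{(S(S-1)-y(m-1))\Lambda}{(x-y)(S-1)}$, $r=\frac{1}{x-y}\left(\frac{(m-S)\Lambda}{S-1}-(S-y)\right)$, $k=\frac{(m-S)(S(S-1)-y(m-1))\Lambda}{(x-y)(S-x)(S-1)}$, $n=\frac{mT}{S}$, $s=\frac{y-S}{x-y}$, $\lambda=k+r+s+rs$. -}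

module Defs where

open import Data.Integer using (ℤ; +_; _+_; _-_; _*_)
open import Data.Product using (_×_)
open import Relation.Binary.PropositionalEquality using (_≡_)
open import Relation.Nullary using (¬_)

-- "num / den is defined and equals the integer q":
-- the denominator is nonzero and q * den = num (so q = num/den in ℚ).
IsIntQuot : ℤ → ℤ → ℤ → Set
IsIntQuot num den q = (¬ den ≡ + 0) × (q * den ≡ num)

p3 : ℤ → ℤ → ℤ → ℤ → ℤ
p3 S m x y =
  S * S * x * x - S * m * x * x - + 2 * S * S * x * y + + 2 * S * m * x * y
  + S * S * y * y - S * m * y * y + S * S * m + + 2 * S * S * x - + 2 * S * m * x
  - + 2 * S * x * x + m * x * x - + 2 * S * S * y + + 2 * S * x * y + S * S
  - + 2 * S * x + x * x

ΛNum : ℤ → ℤ → ℤ → ℤ → ℤ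
ΛNum S m x y = S * (S - + 1) * (S - x) * (S - y)

ΛDen : ℤ → ℤ → ℤ → ℤ → ℤ
ΛDen S m x y =
  S * S * S * S - + 2 * S * S * S
  - ((x + y - + 1) * (m - + 1) - + 1) * S * S + x * y * m * (m - + 1)

Q : ℤ → ℤ → ℤ → ℤ
Q S m y = S * (S - + 1) - y * (m - + 1)

mNum : ℤ → ℤ → ℤ
mNum x z = (x + z * z + z) * (x + z * z + z)

yNum : ℤ → ℤ → ℤ
yNum x z =
  x * x * x + + 2 * x * x * z * z + x * x * z + x * z * z * z * z
  + + 2 * x * z * z * z + + 3 * x * z * z + z * z * z * z * z
  + + 2 * z * z * z * z + z * z * z

yDen : ℤ → ℤ → ℤ
yDen x z = (x + z * z + z) * (x + z * z + z)

-- Writing p₃ = (S(x − y) + S − x)² + m((S − x)² − S(x − y)²) and clearing the denominators of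
-- m₀ = (S₀ + z₀)²/x₀ and y₀ = yNum/(S₀ + z₀)², one finds
--   x₀ (S₀ + z₀)⁴ · p₃(S₀, m₀, x₀, y₀) = 4 x₀ S₀ · cofactor(S₀, z₀) · z₀⁴,
--   cofactor(S, z) = (z+1)(z+2)S³ − zS² − z²(z+3)S − z³.
-- Since S₀ = x₀ + z₀² > z₀², the cofactor is positive: on each of the ranges z ≥ 0, z = −1, z = −2
-- and z ≤ −3 a suitable substitution turns it into a polynomial with natural coefficients and
-- positive constant term. Hence p₃ = 0 forces z₀⁴ = 0.
module Submission where

open import Defs
open import Data.Integer using (ℤ; +_; _+_; _-_; _*_; _<_)
open import Relation.Binary.PropositionalEquality using (_≡_)

open import Data.Integer using (∣_∣; -_; -[1+_]; +[1+_]; +<+; NonZero; >-nonZero)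
open import Data.Integer.Properties
  using (pos-*; *-zeroʳ; *-cancelˡ-≡; i*j≢0; i*j≡0⇒i≡0∨j≡0)
open import Data.Integer.Tactic.RingSolver using (solve-∀)
open import Data.Nat as ℕ using (ℕ; suc; s≤s; z≤n; z<s)
open import Data.Product using (_,_)
open import Data.Sum using ([_,_]′)
open import Function using (id)
open import Relation.Binary.PropositionalEquality
  using (refl; sym; trans; cong; cong₂; subst; module ≡-Reasoning)

infixl 6 _⊕_
infixl 7 _⊗_

data ℕPoly : Set where
  X Y : ℕPoly
  lit : ℕ → ℕPoly
  _⊕_ _⊗_ : ℕPoly → ℕPoly → ℕPoly

⟦_⟧ℕ : ℕPoly → ℕ → ℕ → ℕ
⟦ X ⟧ℕ     m n = m
⟦ Y ⟧ℕ     m n = n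
⟦ lit c ⟧ℕ m n = c
⟦ p ⊕ q ⟧ℕ m n = ⟦ p ⟧ℕ m n ℕ.+ ⟦ q ⟧ℕ m n
⟦ p ⊗ q ⟧ℕ m n = ⟦ p ⟧ℕ m n ℕ.* ⟦ q ⟧ℕ m n

⟦_⟧ℤ : ℕPoly → ℤ → ℤ → ℤ
⟦ X ⟧ℤ     i j = i
⟦ Y ⟧ℤ     i j = j
⟦ lit c ⟧ℤ i j = + c
⟦ p ⊕ q ⟧ℤ i j = ⟦ p ⟧ℤ i j + ⟦ q ⟧ℤ i j
⟦ p ⊗ q ⟧ℤ i j = ⟦ p ⟧ℤ i j * ⟦ q ⟧ℤ i j

pos-⟦⟧ : ∀ p m n → + ⟦ p ⟧ℕ m n ≡ ⟦ p ⟧ℤ (+ m) (+ n)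
pos-⟦⟧ X       m n = refl
pos-⟦⟧ Y       m n = refl
pos-⟦⟧ (lit c) m n = refl
pos-⟦⟧ (p ⊕ q) m n = cong₂ _+_ (pos-⟦⟧ p m n) (pos-⟦⟧ q m n)
pos-⟦⟧ (p ⊗ q) m n = trans (pos-* (⟦ p ⟧ℕ m n) (⟦ q ⟧ℕ m n)) (cong₂ _*_ (pos-⟦⟧ p m n) (pos-⟦⟧ q m n))

-- The instance is found by evaluation whenever p starts with a positive literal summand.
positive-by-expansion : ∀ {i} p m n → i ≡ ⟦ p ⟧ℤ (+ m) (+ n) →
                        .{{ℕ.NonZero (⟦ p ⟧ℕ m n)}} → + 0 < i
positive-by-expansion p m n i≡p =
  subst (+ 0 <_) (sym (trans i≡p (sym (pos-⟦⟧ p m n)))) (+<+ (ℕ.>-nonZero⁻¹ _))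

cofactor : ℤ → ℤ → ℤ
cofactor S z = (z + + 1) * (z + + 2) * S * S * S - z * S * S - z * z * (z + + 3) * S - z * z * z
-- INLINE lets solve-∀ see the body of cofactor wherever it is applied.
{-# INLINE cofactor #-}

cofactor-positive : ∀ k z → + 0 < cofactor (+[1+ k ] + z * z) z
cofactor-positive k (+ n) = positive-by-expansion
  (lit 2 ⊕ Y ⊗ (lit 2 ⊕ Y ⊗ (lit 4 ⊕ Y ⊗ (lit 5 ⊕ Y ⊗ (lit 6 ⊕ Y ⊗ (lit 7 ⊕ Y ⊗ (lit 5 ⊕ Y ⊗ (lit 3 ⊕ Y)))))))
   ⊕ X ⊗ (lit 6 ⊕ Y ⊗ (lit 7 ⊕ Y ⊗ (lit 12 ⊕ Y ⊗ (lit 15 ⊕ Y ⊗ (lit 12 ⊕ Y ⊗ (lit 9 ⊕ Y ⊗ lit 3)))))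
   ⊕ X ⊗ (lit 6 ⊕ Y ⊗ (lit 8 ⊕ Y ⊗ (lit 9 ⊕ Y ⊗ (lit 9 ⊕ Y ⊗ lit 3)))
   ⊕ X ⊗ (lit 2 ⊕ Y ⊗ (lit 3 ⊕ Y)))))
  k n (expansion (+ k) (+ n))
  where
  expansion : ∀ K N → cofactor (+ 1 + K + N * N) N ≡
    + 2 + N * (+ 2 + N * (+ 4 + N * (+ 5 + N * (+ 6 + N * (+ 7 + N * (+ 5 + N * (+ 3 + N)))))))
    + K * (+ 6 + N * (+ 7 + N * (+ 12 + N * (+ 15 + N * (+ 12 + N * (+ 9 + N * + 3)))))
    + K * (+ 6 + N * (+ 8 + N * (+ 9 + N * (+ 9 + N * + 3)))
    + K * (+ 2 + N * (+ 3 + N))))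
  expansion = solve-∀
cofactor-positive k -[1+ 0 ] =
  positive-by-expansion ((lit 1 ⊕ X) ⊗ (lit 1 ⊕ X)) k 0 (expansion (+ k))
  where
  expansion : ∀ K → cofactor (+ 1 + K + + 1) (- + 1) ≡ (+ 1 + K) * (+ 1 + K)
  expansion = solve-∀
cofactor-positive k -[1+ 1 ] =
  positive-by-expansion (lit 38 ⊕ X ⊗ (lit 16 ⊕ X ⊗ lit 2)) k 0 (expansion (+ k))
  where
  expansion : ∀ K → cofactor (+ 1 + K + + 4) (- + 2) ≡ + 38 + K * (+ 16 + K * + 2)
  expansion = solve-∀
cofactor-positive k z@(-[1+ suc (suc w) ]) = positive-by-expansion
  ((lit 3 ⊕ Y) ⊗ (lit 3 ⊕ Y) ⊗ (lit 3 ⊕ Y)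
   ⊕ X ⊗ (Y ⊗ (lit 3 ⊕ Y) ⊗ (lit 3 ⊕ Y) ⊕ X ⊗ (lit 3 ⊕ Y ⊕ X ⊗ (lit 1 ⊕ Y) ⊗ (lit 2 ⊕ Y))))
  ∣ S ∣ w (expansion S (+ w))
  where
  -- S evaluates to a term + s, so + ∣ S ∣ is S by definition.
  S : ℤ
  S = +[1+ k ] + z * z
  expansion : ∀ S W → cofactor S (- (+ 3 + W)) ≡
    (+ 3 + W) * (+ 3 + W) * (+ 3 + W)
    + S * (W * (+ 3 + W) * (+ 3 + W) + S * (+ 3 + W + S * (+ 1 + W) * (+ 2 + W)))
  expansion = solve-∀

positive+square-positive : ∀ k z → + 0 < +[1+ k ] + z * z
positive+square-positive k (+ n) rewrite sym (pos-* n n) = +<+ z<s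
positive+square-positive k -[1+ n ]                        = +<+ z<s

p3-cleared : ℤ → ℤ → ℤ → ℤ → ℤ → ℤ
p3-cleared S mx x yA A =
  let u = S * (x * A - yA) + (S - x) * A
      v = (S - x) * A
      w = x * A - yA
  in x * (u * u) + mx * (v * v - S * (w * w))
{-# INLINE p3-cleared #-}

p3-clear-denominators : ∀ S m x y A → x * (A * A) * p3 S m x y ≡ p3-cleared S (m * x) x (y * A) A
p3-clear-denominators = unfolded
  where
  -- solve-∀ treats p3, mNum, yNum and yDen from Defs as constants, so their bodies are spelled out.
  unfolded : ∀ S m x y A → x * (A * A) *
    (S * S * x * x - S * m * x * x - + 2 * S * S * x * y + + 2 * S * m * x * y
    + S * S * y * y - S * m * y * y + S * S * m + + 2 * S * S * x - + 2 * S * m * x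
    - + 2 * S * x * x + m * x * x - + 2 * S * S * y + + 2 * S * x * y + S * S
    - + 2 * S * x + x * x)
    ≡ p3-cleared S (m * x) x (y * A) A
  unfolded = solve-∀

p3-cleared-factorisation : ∀ x z → let S = x + z * z in
  p3-cleared S (mNum x z) x (yNum x z) (yDen x z) ≡ + 4 * x * S * cofactor S z * (z * z * (z * z))
p3-cleared-factorisation = unfolded
  where
  unfolded : ∀ x z → let S = x + z * z; A = (S + z) * (S + z) in
    p3-cleared S A x
      (x * x * x + + 2 * x * x * z * z + x * x * z + x * z * z * z * z
      + + 2 * x * z * z * z + + 3 * x * z * z + z * z * z * z * z
      + + 2 * z * z * z * z + z * z * z) A
    ≡ + 4 * x * S * cofactor S z * (z * z * (z * z))
  unfolded = solve-∀

i*i≡0⇒i≡0 : ∀ i → i * i ≡ + 0 → i ≡ + 0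
i*i≡0⇒i≡0 i i*i≡0 = [ id , id ]′ (i*j≡0⇒i≡0∨j≡0 i i*i≡0)

p3≡0⇒z≡0 : ∀ {x z m y} → + 0 < x → m * x ≡ mNum x z → y * yDen x z ≡ yNum x z →
           p3 (x + z * z) m x y ≡ + 0 → z ≡ + 0
p3≡0⇒z≡0 {_} {z} {m} {y} (+<+ (s≤s {n = k} z≤n)) m*x≡ y*A≡ p3≡0 =
  i*i≡0⇒i≡0 z (i*i≡0⇒i≡0 (z * z) (*-cancelˡ-≡ c (z * z * (z * z)) (+ 0) c*z⁴≡c*0))
  where
  open ≡-Reasoning
  x S A c : ℤ
  x = +[1+ k ]
  S = x + z * z
  A = yDen x z
  c = + 4 * x * S * cofactor S z
  instance
    S≢0 : NonZero S
    S≢0 = >-nonZero (positive+square-positive k z)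
    cofactor≢0 : NonZero (cofactor S z)
    cofactor≢0 = >-nonZero (cofactor-positive k z)
    c≢0 : NonZero c
    c≢0 = i*j≢0 (+ 4 * x * S) (cofactor S z) {{i*j≢0 (+ 4 * x) S}}
  c*z⁴≡c*0 : c * (z * z * (z * z)) ≡ c * + 0
  c*z⁴≡c*0 = begin
    c * (z * z * (z * z))                        ≡⟨ p3-cleared-factorisation x z ⟨
    p3-cleared S (mNum x z) x (yNum x z) A       ≡⟨ cong₂ (λ mx yA → p3-cleared S mx x yA A) m*x≡ y*A≡ ⟨
    p3-cleared S (m * x) x (y * A) A             ≡⟨ p3-clear-denominators S m x y A ⟨
    x * (A * A) * p3 S m x y                     ≡⟨ cong (x * (A * A) *_) p3≡0 ⟩
    x * (A * A) * + 0                            ≡⟨ *-zeroʳ (x * (A * A)) ⟩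
    + 0                                          ≡⟨ *-zeroʳ c ⟨
    c * + 0                                      ∎

proposition3 : (x₀ z₀ : ℤ) → + 0 < x₀ →
    (S₀ m₀ y₀ Λ T n k r s λ′ N P : ℤ) →
    S₀ ≡ x₀ + z₀ * z₀ →
    IsIntQuot (mNum x₀ z₀) x₀ m₀ →
    IsIntQuot (yNum x₀ z₀) (yDen x₀ z₀) y₀ →
    IsIntQuot (ΛNum S₀ m₀ x₀ y₀) (ΛDen S₀ m₀ x₀ y₀) Λ →
    IsIntQuot ((m₀ - + 1) * Λ) (S₀ - + 1) T →
    IsIntQuot (m₀ * T) S₀ n →
    IsIntQuot ((m₀ - S₀) * Q S₀ m₀ y₀ * Λ) ((x₀ - y₀) * (S₀ - x₀) * (S₀ - + 1)) k →
    IsIntQuot ((m₀ - S₀) * Λ - (S₀ - y₀) * (S₀ - + 1)) ((x₀ - y₀) * (S₀ - + 1)) r →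
    IsIntQuot (y₀ - S₀) (x₀ - y₀) s →
    λ′ ≡ k + r + s + r * s →
    IsIntQuot (x₀ * (m₀ - S₀) * Q S₀ m₀ y₀ * Λ) (S₀ * (x₀ - y₀) * (S₀ - x₀) * (S₀ - + 1)) N →
    IsIntQuot (Q S₀ m₀ y₀ * Λ) ((x₀ - y₀) * (S₀ - + 1)) P →
    p3 S₀ m₀ x₀ y₀ ≡ + 0 →
    z₀ ≡ + 0
proposition3 _ _ 0<x₀ _ _ _ _ _ _ _ _ _ _ _ _ refl (_ , m₀x₀≡) (_ , y₀A≡) _ _ _ _ _ _ _ _ _ p3≡0 =
  p3≡0⇒z≡0 0<x₀ m₀x₀≡ y₀A≡ p3≡0
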